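{- Starting with a $2$-approximate solution $s$ that is a maximal solution for the dual problem, RLS restores the quality of $2$-approximation (i.e. reaches a maximal solution of the dual problem for the new graph) when one edge is dynamically added to or deleted from the graph, in expected time $O(w_{\max}\cdot m)$.
   Context: Weighted vertex cover: graph $G=(V,E)$, $V=\{v_1,\dots,v_n\}$, $E=\{e_1,\dots,e_m\}$, vertex weights $w:V\to\mathbb{N}^+$, $w_{\max}=\max_v w(v)$. Dual problem: a solution is $s\in\mathbb{N}_0^m$ (weight $s_j$ on edge $e_j$), maximise $\sum_j s_j$ subject to $\sum_{j: v\in e_j}s_j\le w(v)$ for all $v$. A node $v$ is tight if $\sum_{j:v\in e_j}s_j=w(v)$; $V_C(s)$ is the set of tight nodes; an edge is uncovered if neither endpoint is tight. A feasible dual solution is maximal if no edge weight can be increased by $1$ without violating a constraint; its tight nodes form a vertex cover of weight at most twice the optimum ($2$-approximation). Fitness (to be maximised), with $W_{tot}=\sum_i w(v_i)$: $f(s)=\sum_i s_i-(W_{tot}+1)\cdot|\{e\in E\mid e\cap V_C(s)=\emptyset\}|-(m+1)(W_{tot}+1)\cdot|\{v\mid \sum_{j:v\in e_j}s_j>w(v)\}|$. RLS: in each iteration choose $i\in\{1,\dots,m\}$ uniformly at random and, with probability $1/2$ each, set $s'_i=s_i+1$ or $s'_i=\max\{s_i-1,0\}$ (other entries unchanged); replace $s$ by $s'$ iff $f(s')>f(s)$. Dynamic changes: a newly added edge gets weight $0$ in the current solution; a deleted edge is removed together with its weight. $m$ is the (maximum) number of edges; time is measured in iterations. -}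

module Defs where

open import Data.Nat as ℕ using (ℕ; zero; suc; _+_; _*_; _≤_; _⊔_)
open import Data.Nat.Properties using (_≟_; _≤?_)
open import Data.Integer as ℤ using (ℤ; +_)
open import Data.Rational as ℚ using (ℚ; 0ℚ; 1ℚ; _/_)
open import Data.Fin using (Fin)
open import Data.Fin.Properties using (all?)
open import Data.Product using (_×_; _,_; proj₁; proj₂)
open import Data.Bool using (Bool; true; false; if_then_else_)
open import Relation.Nullary using (Dec; yes; no; ¬_; ¬?)
open import Relation.Nullary.Decidable using (⌊_⌋; _×-dec_)
open import Relation.Binary.PropositionalEquality using (_≡_; _≢_)
open import Data.Vec.Functional using (Vector; foldr; updateAt)

sumℕ : ∀ {m} → (Fin m → ℕ) → ℕ
sumℕ = foldr _+_ 0

maxℕ : ∀ {n} → (Fin n → ℕ) → ℕ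
maxℕ = foldr _⊔_ 0

sumℚ : ∀ {m} → (Fin m → ℚ) → ℚ
sumℚ = foldr ℚ._+_ 0ℚ

count : ∀ {m} {P : Fin m → Set} → ((i : Fin m) → Dec (P i)) → ℕ
count P? = sumℕ (λ i → if ⌊ P? i ⌋ then 1 else 0)

Graph : ℕ → ℕ → Set
Graph n m = Fin m → Fin n × Fin n

SameEnds : ∀ {n} → Fin n × Fin n → Fin n × Fin n → Set
SameEnds (a , b) (c , d) = (a ≡ c × b ≡ d) Data.Sum.⊎ (a ≡ d × b ≡ c)
  where import Data.Sum

Simple : ∀ {n m} → Graph n m → Set
Simple {n} {m} G =
  (∀ j → proj₁ (G j) ≢ proj₂ (G j)) ×
  (∀ i j → SameEnds (G i) (G j) → i ≡ j)

incident? : ∀ {n m} (G : Graph n m) (v : Fin n) (j : Fin m) → Bool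
incident? G v j = ⌊ v Data.Fin.≟ proj₁ (G j) ⌋ Data.Bool.∨ ⌊ v Data.Fin.≟ proj₂ (G j) ⌋
  where import Data.Bool

-- dual solutions: weight s j on edge e_j
Sol : ℕ → Set
Sol m = Vector ℕ m

load : ∀ {n m} → Graph n m → Sol m → Fin n → ℕ
load G s v = sumℕ (λ j → if incident? G v j then s j else 0)

Tight : ∀ {n m} → Graph n m → (Fin n → ℕ) → Sol m → Fin n → Set
Tight G w s v = load G s v ≡ w v

Feasible : ∀ {n m} → Graph n m → (Fin n → ℕ) → Sol m → Set
Feasible G w s = ∀ v → load G s v ≤ w v

inc : ∀ {m} → Fin m → Sol m → Sol m
inc j s = updateAt s j suc

Maximal : ∀ {n m} → Graph n m → (Fin n → ℕ) → Sol m → Set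
Maximal G w s = Feasible G w s × (∀ j → ¬ Feasible G w (inc j s))

feasible? : ∀ {n m} (G : Graph n m) w s → Dec (Feasible G w s)
feasible? G w s = all? (λ v → load G s v ≤? w v)

maximal? : ∀ {n m} (G : Graph n m) w s → Dec (Maximal G w s)
maximal? G w s = feasible? G w s ×-dec all? (λ j → ¬? (feasible? G w (inc j s)))

Wtot : ∀ {n} → (Fin n → ℕ) → ℕ
Wtot w = sumℕ w

uncovered : ∀ {n m} → Graph n m → (Fin n → ℕ) → Sol m → ℕ
uncovered G w s =
  count (λ j → ¬? (load G s (proj₁ (G j)) ≟ w (proj₁ (G j)))
          ×-dec ¬? (load G s (proj₂ (G j)) ≟ w (proj₂ (G j))))

violated : ∀ {n m} → Graph n m → (Fin n → ℕ) → Sol m → ℕ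
violated G w s = count (λ v → w v ℕ.<? load G s v)

fitness : ∀ {n m} → Graph n m → (Fin n → ℕ) → Sol m → ℤ
fitness {m = m} G w s =
  + sumℕ s
  ℤ.- + ((Wtot w + 1) * uncovered G w s)
  ℤ.- + ((m + 1) * (Wtot w + 1) * violated G w s)

mutate : ∀ {m} → Fin m → Bool → Sol m → Sol m
mutate j true  s = updateAt s j suc
mutate j false s = updateAt s j ℕ.pred

rlsStep : ∀ {n m} → Graph n m → (Fin n → ℕ) → Sol m → Fin m → Bool → Sol m
rlsStep G w s j b with fitness G w s ℤ.<? fitness G w (mutate j b s)
... | yes _ = mutate j b s
... | no  _ = s

-- average over the 2m equally likely (edge, direction) choices
-- (with m = 0 there is no choice; this case is never reached below,
--  since with no edges every feasible solution is maximal)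
average : ∀ {m} → (Fin m → Bool → ℚ) → ℚ
average {zero}  g = 0ℚ
average {suc k} g =
  ((+ 1) / (2 * suc k)) ℚ.* sumℚ (λ j → g j true ℚ.+ g j false)

-- notDone G w t s = Pr[T > t], where T is the number of RLS iterations
-- until the current solution is a maximal dual solution of G,
-- when RLS is started in s.
notDone : ∀ {n m} → Graph n m → (Fin n → ℕ) → ℕ → Sol m → ℚ
notDone G w t s with maximal? G w s
notDone G w t       s | yes _ = 0ℚ
notDone G w zero    s | no  _ = 1ℚ
notDone G w (suc t) s | no  _ = average (λ j b → notDone G w t (rlsStep G w s j b))

-- Σ_{t < N} Pr[T > t]; E[T] = sup_N of these partial sums
expectedUpTo : ∀ {n m} → Graph n m → (Fin n → ℕ) → Sol m → ℕ → ℚ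
expectedUpTo G w s zero    = 0ℚ
expectedUpTo G w s (suc N) = expectedUpTo G w s N ℚ.+ notDone G w N s

module Submission where

-- Let e_j = {u, v} be the edge that changes.  Call a dual solution s of the
-- new graph *almost covering* if it is feasible and every edge has an endpoint
-- that is tight or equal to u or v.  The old maximal solution, extended by
-- weight 0 on an inserted edge or restricted after a deletion, is almost
-- covering.  From a feasible solution RLS accepts exactly the feasible
-- increments (infeasibility and decrements are penalised by the fitness), and
-- increments keep tight nodes tight; hence almost covering is invariant and the
-- potential Φ(s) = slack(u) + slack(v) ≤ 2·w_max never increases.  While s is
-- not maximal some increment e_k is feasible; the good endpoint of e_k is then
-- not tight, so it is u or v, and the accepted move "increase s_k" lowers Φ.
-- A general drift theorem turns this into E[T] ≤ 2m·Φ(s₀) ≤ 4·w_max·(m+1).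

open import Data.Nat as ℕ using (ℕ; zero; suc; _+_; _*_; _∸_; _≤_; _<_; z≤n; s≤s)
import Data.Nat.Properties as ℕP
open import Data.Nat.Tactic.RingSolver using (solve-∀)
open import Data.Integer as ℤ using (+_)
import Data.Integer.Properties as ℤP
import Data.Integer.Tactic.RingSolver as ℤ-Ring
open import Data.Rational as ℚ using (ℚ; mkℚ; 0ℚ; 1ℚ; _/_)
import Data.Rational.Properties as ℚP
import Data.Nat.Coprimality as Coprime
open import Algebra.Bundles using (CommutativeMonoid)
open import Algebra.Properties.CommutativeSemigroup
  (CommutativeMonoid.commutativeSemigroup ℚP.+-0-commutativeMonoid) using (interchange)
open import Data.Fin as Fin using (Fin; zero; suc; punchIn; punchOut)
import Data.Fin.Properties as FinP
open import Data.Bool using (Bool; true; false; if_then_else_)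
open import Data.Product using (Σ; _×_; _,_; proj₁; proj₂)
open import Data.Sum as Sum using (_⊎_; inj₁; inj₂)
open import Data.Empty using (⊥-elim)
open import Function using (_∘′_)
open import Relation.Nullary using (Dec; yes; no; ¬_; ¬?)
open import Relation.Nullary.Decidable using (⌊_⌋; decidable-stable; _×-dec_)
open import Relation.Binary.PropositionalEquality
open import Data.Vec.Functional using (updateAt; removeAt; insertAt)
import Data.Vec.Functional.Properties as VecP
open import Defs

⟦_⟧ : ℕ → ℚ
⟦ n ⟧ = + n / 1

⟦⟧-normal : ∀ n → ⟦ n ⟧ ≡ mkℚ (+ n) 0 (Coprime.sym (Coprime.1-coprimeTo n))
⟦⟧-normal n = ℚP.normalize-coprime (Coprime.sym (Coprime.1-coprimeTo n))

⟦⟧-+ : ∀ a b → ⟦ a ⟧ ℚ.+ ⟦ b ⟧ ≡ ⟦ a + b ⟧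
⟦⟧-+ a b = trans (cong₂ ℚ._+_ (⟦⟧-normal a) (⟦⟧-normal b))
  (cong (_/ 1) (trans (cong₂ ℤ._+_ (ℤP.*-identityʳ (+ a)) (ℤP.*-identityʳ (+ b))) (sym (ℤP.pos-+ a b))))

⟦⟧-* : ∀ a b → ⟦ a ⟧ ℚ.* ⟦ b ⟧ ≡ ⟦ a * b ⟧
⟦⟧-* a b = trans (cong₂ ℚ._*_ (⟦⟧-normal a) (⟦⟧-normal b)) (cong (_/ 1) (sym (ℤP.pos-* a b)))

⟦⟧-mono : ∀ {a b} → a ≤ b → ⟦ a ⟧ ℚ.≤ ⟦ b ⟧
⟦⟧-mono {a} {b} a≤b = subst₂ ℚ._≤_ (sym (⟦⟧-normal a)) (sym (⟦⟧-normal b))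
  (ℚ.*≤* (subst₂ ℤ._≤_ (sym (ℤP.*-identityʳ (+ a))) (sym (ℤP.*-identityʳ (+ b))) (ℤ.+≤+ a≤b)))

⟦⟧-nonneg : ∀ n → 0ℚ ℚ.≤ ⟦ n ⟧
⟦⟧-nonneg n = ⟦⟧-mono {0} {n} z≤n

reciprocal-inverse : ∀ k → (+ 1 / suc k) ℚ.* ⟦ suc k ⟧ ≡ 1ℚ
reciprocal-inverse k =
  trans (cong₂ ℚ._*_ (ℚP.normalize-coprime (Coprime.1-coprimeTo (suc k))) (⟦⟧-normal (suc k)))
        (ℚP.*-inverseˡ (mkℚ (+ suc k) 0 (Coprime.sym (Coprime.1-coprimeTo (suc k)))))

sumℕ-ext : ∀ {m} {f g : Fin m → ℕ} → (∀ j → f j ≡ g j) → sumℕ f ≡ sumℕ g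
sumℕ-ext {zero}  f≡g = refl
sumℕ-ext {suc m} f≡g = cong₂ _+_ (f≡g zero) (sumℕ-ext (λ j → f≡g (suc j)))

sumℚ-ext : ∀ {m} {f g : Fin m → ℚ} → (∀ j → f j ≡ g j) → sumℚ f ≡ sumℚ g
sumℚ-ext {zero}  f≡g = refl
sumℚ-ext {suc m} f≡g = cong₂ ℚ._+_ (f≡g zero) (sumℚ-ext (λ j → f≡g (suc j)))

sumℕ-mono : ∀ {m} {f g : Fin m → ℕ} → (∀ j → f j ≤ g j) → sumℕ f ≤ sumℕ g
sumℕ-mono {zero}  f≤g = z≤n
sumℕ-mono {suc m} f≤g = ℕP.+-mono-≤ (f≤g zero) (sumℕ-mono (λ j → f≤g (suc j)))

sumℚ-mono : ∀ {m} {f g : Fin m → ℚ} → (∀ j → f j ℚ.≤ g j) → sumℚ f ℚ.≤ sumℚ g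
sumℚ-mono {zero}  f≤g = ℚP.≤-refl
sumℚ-mono {suc m} f≤g = ℚP.+-mono-≤ (f≤g zero) (sumℚ-mono (λ j → f≤g (suc j)))

sumℕ-scale : ∀ {m} c (f : Fin m → ℕ) → sumℕ (λ j → c * f j) ≡ c * sumℕ f
sumℕ-scale {zero}  c f = sym (ℕP.*-zeroʳ c)
sumℕ-scale {suc m} c f = trans (cong (λ x → c * f zero + x) (sumℕ-scale c (λ j → f (suc j))))
  (sym (ℕP.*-distribˡ-+ c (f zero) _))

sumℚ-⟦⟧ : ∀ {m} (f : Fin m → ℕ) → sumℚ (λ j → ⟦ f j ⟧) ≡ ⟦ sumℕ f ⟧
sumℚ-⟦⟧ {zero}  f = refl
sumℚ-⟦⟧ {suc m} f = trans (cong (⟦ f zero ⟧ ℚ.+_) (sumℚ-⟦⟧ (λ j → f (suc j))))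
  (⟦⟧-+ (f zero) (sumℕ (λ j → f (suc j))))

sumℚ-+ : ∀ {m} (f g : Fin m → ℚ) → sumℚ f ℚ.+ sumℚ g ≡ sumℚ (λ j → f j ℚ.+ g j)
sumℚ-+ {zero}  f g = ℚP.+-identityˡ 0ℚ
sumℚ-+ {suc m} f g = trans (interchange (f zero) _ (g zero) _)
  (cong ((f zero ℚ.+ g zero) ℚ.+_) (sumℚ-+ (λ j → f (suc j)) (λ j → g (suc j))))

sumℚ-0 : ∀ {m} → sumℚ {m} (λ _ → 0ℚ) ≡ 0ℚ
sumℚ-0 {zero}  = refl
sumℚ-0 {suc m} = trans (cong (0ℚ ℚ.+_) (sumℚ-0 {m})) (ℚP.+-identityˡ 0ℚ)

sum-≤-bound : ∀ {m} (h : Fin m → ℕ) B → (∀ j → h j ≤ B) → sumℕ h ≤ m * B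
sum-≤-bound {zero}  h B h≤B = z≤n
sum-≤-bound {suc m} h B h≤B = ℕP.+-mono-≤ (h≤B zero) (sum-≤-bound (λ j → h (suc j)) B (λ j → h≤B (suc j)))

sum-<-bound : ∀ {m} (h : Fin m → ℕ) B → (∀ j → h j ≤ B) → (j₀ : Fin m) → h j₀ < B → sumℕ h < m * B
sum-<-bound {suc m} h B h≤B zero     h₀<B = ℕP.+-mono-≤ h₀<B (sum-≤-bound (λ j → h (suc j)) B (λ j → h≤B (suc j)))
sum-<-bound {suc m} h B h≤B (suc j₀) h₀<B = subst (_≤ suc m * B) (ℕP.+-suc (h zero) _)
  (ℕP.+-mono-≤ (h≤B zero) (sum-<-bound (λ j → h (suc j)) B (λ j → h≤B (suc j)) j₀ h₀<B))

sum-removeAt : ∀ {m} (f : Fin (suc m) → ℕ) k → sumℕ f ≡ f k + sumℕ (removeAt f k)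
sum-removeAt f zero = refl
sum-removeAt {suc m} f (suc k) = trans (cong (λ x → f zero + x) (sum-removeAt (λ j → f (suc j)) k))
  (swap (f zero) (f (suc k)) _)
  where
  swap : ∀ x y z → x + (y + z) ≡ y + (x + z)
  swap = solve-∀

sum-update : ∀ {m} (f g : Fin m → ℕ) k d → g k ≡ f k + d → (∀ j → j ≢ k → g j ≡ f j) →
  sumℕ g ≡ sumℕ f + d
sum-update {suc m} f g zero d gₖ others =
  trans (cong₂ _+_ gₖ (sumℕ-ext (λ j → others (suc j) (λ ())))) (reorder (f zero) _ d)
  where
  reorder : ∀ x y z → (x + z) + y ≡ (x + y) + z
  reorder = solve-∀
sum-update {suc m} f g (suc k) d gₖ others =
  trans (cong₂ _+_ (others zero (λ ()))
          (sum-update (λ j → f (suc j)) (λ j → g (suc j)) k d gₖ (λ j j≢k → others (suc j) (j≢k ∘′ FinP.suc-injective))))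
        (sym (ℕP.+-assoc (f zero) _ d))

≤-maxℕ : ∀ {n} (w : Fin n → ℕ) x → w x ≤ maxℕ w
≤-maxℕ w zero    = ℕP.m≤m⊔n (w zero) _
≤-maxℕ w (suc x) = ℕP.≤-trans (≤-maxℕ (λ y → w (suc y)) x) (ℕP.m≤n⊔m (w zero) _)

average-+ : ∀ {m} (f g : Fin m → Bool → ℚ) →
  average f ℚ.+ average g ≡ average (λ j b → f j b ℚ.+ g j b)
average-+ {zero}  f g = ℚP.+-identityˡ 0ℚ
average-+ {suc k} f g = trans (sym (ℚP.*-distribˡ-+ (+ 1 / (2 * suc k)) _ _))
  (cong ((+ 1 / (2 * suc k)) ℚ.*_)
    (trans (sumℚ-+ (λ j → f j true ℚ.+ f j false) (λ j → g j true ℚ.+ g j false))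
           (sumℚ-ext (λ j → interchange (f j true) (f j false) (g j true) (g j false)))))

average-0 : ∀ {m} → average {m} (λ _ _ → 0ℚ) ≡ 0ℚ
average-0 {zero}  = refl
average-0 {suc k} = trans (cong ((+ 1 / (2 * suc k)) ℚ.*_)
    (trans (sumℚ-ext {suc k} (λ _ → ℚP.+-identityˡ 0ℚ)) (sumℚ-0 {suc k})))
  (ℚP.*-zeroʳ (+ 1 / (2 * suc k)))

average-mono : ∀ {m} {f g : Fin m → Bool → ℚ} → (∀ j b → f j b ℚ.≤ g j b) → average f ℚ.≤ average g
average-mono {zero}  f≤g = ℚP.≤-refl
average-mono {suc k} f≤g = ℚP.*-monoˡ-≤-nonNeg (+ 1 / (2 * suc k)) {{ℚP.normalize-nonNeg 1 (2 * suc k)}}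
  (sumℚ-mono (λ j → ℚP.+-mono-≤ (f≤g j true) (f≤g j false)))

average-scaled : ∀ k (g : Fin (suc k) → Bool → ℕ) →
  average (λ j b → ⟦ 2 * suc k * g j b ⟧) ≡ ⟦ sumℕ (λ j → g j true + g j false) ⟧
average-scaled k g = begin
    r ℚ.* sumℚ (λ j → ⟦ c * g j true ⟧ ℚ.+ ⟦ c * g j false ⟧)
  ≡⟨ cong (r ℚ.*_) (sumℚ-ext (λ j → trans (⟦⟧-+ (c * g j true) (c * g j false))
                                         (cong ⟦_⟧ (sym (ℕP.*-distribˡ-+ c (g j true) (g j false)))))) ⟩
    r ℚ.* sumℚ (λ j → ⟦ c * h j ⟧)
  ≡⟨ cong (r ℚ.*_) (trans (sumℚ-⟦⟧ (λ j → c * h j)) (cong ⟦_⟧ (sumℕ-scale c h))) ⟩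
    r ℚ.* ⟦ c * sumℕ h ⟧
  ≡⟨ cong (r ℚ.*_) (sym (⟦⟧-* c (sumℕ h))) ⟩
    r ℚ.* (⟦ c ⟧ ℚ.* ⟦ sumℕ h ⟧)
  ≡⟨ sym (ℚP.*-assoc r ⟦ c ⟧ ⟦ sumℕ h ⟧) ⟩
    (r ℚ.* ⟦ c ⟧) ℚ.* ⟦ sumℕ h ⟧
  ≡⟨ cong (ℚ._* ⟦ sumℕ h ⟧) (reciprocal-inverse (k + 1 * suc k)) ⟩  -- 2·(k+1) = suc (k + 1·(k+1))
    1ℚ ℚ.* ⟦ sumℕ h ⟧
  ≡⟨ ℚP.*-identityˡ _ ⟩
    ⟦ sumℕ h ⟧ ∎
  where
  open ≡-Reasoning
  c : ℕ
  c = 2 * suc k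
  r : ℚ
  r = + 1 / (2 * suc k)
  h : Fin (suc k) → ℕ
  h j = g j true + g j false

drift-step : ∀ {m} (F : Fin m → Bool → ℚ) (P : ℕ) (g : Fin m → Bool → ℕ) →
  (∀ j b → F j b ℚ.≤ ⟦ 2 * m * g j b ⟧) → (∀ j b → g j b ≤ P) →
  (j₀ : Fin m) (b₀ : Bool) → g j₀ b₀ < P → 1ℚ ℚ.+ average F ℚ.≤ ⟦ 2 * m * P ⟧
drift-step {suc k} F P g F≤g g≤P j₀ b₀ g₀<P = begin
    1ℚ ℚ.+ average F
  ≤⟨ ℚP.+-monoʳ-≤ 1ℚ (average-mono F≤g) ⟩
    1ℚ ℚ.+ average (λ j b → ⟦ 2 * suc k * g j b ⟧)
  ≡⟨ cong (1ℚ ℚ.+_) (average-scaled k g) ⟩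
    ⟦ 1 ⟧ ℚ.+ ⟦ sumℕ h ⟧
  ≡⟨ ⟦⟧-+ 1 (sumℕ h) ⟩
    ⟦ suc (sumℕ h) ⟧
  ≤⟨ ⟦⟧-mono (subst (suc (sumℕ h) ≤_) (rearrange (suc k) P) (sum-<-bound h (P + P) h≤2P j₀ (h₀<2P b₀ g₀<P))) ⟩
    ⟦ 2 * suc k * P ⟧ ∎
  where
  open ℚP.≤-Reasoning
  h : Fin (suc k) → ℕ
  h j = g j true + g j false
  h≤2P : ∀ j → h j ≤ P + P
  h≤2P j = ℕP.+-mono-≤ (g≤P j true) (g≤P j false)
  h₀<2P : ∀ b → g j₀ b < P → h j₀ < P + P
  h₀<2P true  lt = ℕP.+-mono-≤ lt (g≤P j₀ false)
  h₀<2P false lt = subst (_≤ P + P) (ℕP.+-suc (g j₀ true) _) (ℕP.+-mono-≤ (g≤P j₀ true) lt)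
  rearrange : ∀ m P → m * (P + P) ≡ 2 * m * P
  rearrange = solve-∀

count-zero : ∀ {m} {P : Fin m → Set} (P? : (i : Fin m) → Dec (P i)) → (∀ i → ¬ P i) → count P? ≡ 0
count-zero {zero}  P? none = refl
count-zero {suc m} P? none with P? zero
... | yes p = ⊥-elim (none zero p)
... | no _  = count-zero (λ i → P? (suc i)) (λ i → none (suc i))

count-pos : ∀ {m} {P : Fin m → Set} (P? : (i : Fin m) → Dec (P i)) i → P i → 1 ≤ count P?
count-pos {suc m} P? zero p with P? zero
... | yes _ = s≤s z≤n
... | no ¬p = ⊥-elim (¬p p)
count-pos {suc m} P? (suc i) p =
  ℕP.≤-trans (count-pos (λ i → P? (suc i)) i p) (ℕP.m≤n+m _ (if ⌊ P? zero ⌋ then 1 else 0))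

count-≤ : ∀ {m} {P : Fin m → Set} (P? : (i : Fin m) → Dec (P i)) → count P? ≤ m
count-≤ {zero}  P? = z≤n
count-≤ {suc m} P? = ℕP.+-mono-≤ (indicator-≤ (P? zero)) (count-≤ (λ i → P? (suc i)))
  where
  indicator-≤ : ∀ {A : Set} (d : Dec A) → (if ⌊ d ⌋ then 1 else 0) ≤ 1
  indicator-≤ (yes _) = s≤s z≤n
  indicator-≤ (no _)  = z≤n

count-mono : ∀ {m} {P Q : Fin m → Set} (P? : (i : Fin m) → Dec (P i)) (Q? : (i : Fin m) → Dec (Q i)) →
  (∀ i → P i → Q i) → count P? ≤ count Q?
count-mono P? Q? P⇒Q = sumℕ-mono (λ i → indicator-mono (P? i) (Q? i) (P⇒Q i))
  where
  indicator-mono : ∀ {A B : Set} (d : Dec A) (e : Dec B) → (A → B) →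
    (if ⌊ d ⌋ then 1 else 0) ≤ (if ⌊ e ⌋ then 1 else 0)
  indicator-mono (yes a) (yes _) _   = ℕP.≤-refl
  indicator-mono (yes a) (no ¬b) A⇒B = ⊥-elim (¬b (A⇒B a))
  indicator-mono (no _)  _       _   = z≤n

difference-shift : ∀ a p q → (+ a ℤ.- + p) ℤ.+ + (p + q) ≡ + (a + q)
difference-shift a p q = begin
    (+ a ℤ.- + p) ℤ.+ + (p + q)
  ≡⟨ cong (λ x → (+ a ℤ.- + p) ℤ.+ x) (ℤP.pos-+ p q) ⟩
    (+ a ℤ.- + p) ℤ.+ (+ p ℤ.+ + q)
  ≡⟨ cancel (+ a) (+ p) (+ q) ⟩
    + a ℤ.+ + q
  ≡⟨ sym (ℤP.pos-+ a q) ⟩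
    + (a + q) ∎
  where
  open ≡-Reasoning
  cancel : ∀ x y z → (x ℤ.- y) ℤ.+ (y ℤ.+ z) ≡ x ℤ.+ z
  cancel = ℤ-Ring.solve-∀

difference-shift′ : ∀ a p q → (+ a ℤ.- + p) ℤ.+ + (q + p) ≡ + (a + q)
difference-shift′ a p q =
  trans (cong (λ x → (+ a ℤ.- + p) ℤ.+ x) (cong +_ (ℕP.+-comm q p))) (difference-shift a p q)

-- a − p < a' − p' in ℤ exactly when a + p' < a' + p in ℕ: add p + p' to both sides.
difference-<⇒ : ∀ a p a' p' → + a ℤ.- + p ℤ.< + a' ℤ.- + p' → a + p' < a' + p
difference-<⇒ a p a' p' lt = ℤP.drop‿+<+
  (subst₂ ℤ._<_ (difference-shift a p p') (difference-shift′ a' p' p) (ℤP.+-monoˡ-< (+ (p + p')) lt))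

difference-<⇐ : ∀ a p a' p' → a + p' < a' + p → + a ℤ.- + p ℤ.< + a' ℤ.- + p'
difference-<⇐ a p a' p' lt = ℤP.≰⇒> λ ≥ → ℤP.<⇒≱ shifted (ℤP.+-monoˡ-≤ (+ (p + p')) ≥)
  where
  shifted : (+ a ℤ.- + p) ℤ.+ + (p + p') ℤ.< (+ a' ℤ.- + p') ℤ.+ + (p + p')
  shifted = subst₂ ℤ._<_ (sym (difference-shift a p p')) (sym (difference-shift′ a' p' p)) (ℤ.+<+ lt)

module Dynamics {n m} (G : Graph n m) (w : Fin n → ℕ) where

  first second : Fin m → Fin n
  first  k = proj₁ (G k)
  second k = proj₂ (G k)

  incident-first : ∀ k → incident? G (first k) k ≡ true
  incident-first k with first k Fin.≟ first k
  ... | yes _  = refl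
  ... | no ≢    = ⊥-elim (≢ refl)

  incident-second : ∀ k → incident? G (second k) k ≡ true
  incident-second k with second k Fin.≟ first k | second k Fin.≟ second k
  ... | yes _ | _     = refl
  ... | no _  | yes _ = refl
  ... | no _  | no ≢  = ⊥-elim (≢ refl)

  incident⇒endpoint : ∀ x k → incident? G x k ≡ true → x ≡ first k ⊎ x ≡ second k
  incident⇒endpoint x k inc with x Fin.≟ first k | x Fin.≟ second k | inc
  ... | yes x≡first | _            | _  = inj₁ x≡first
  ... | no _        | yes x≡second | _  = inj₂ x≡second
  ... | no _        | no _         | ()

  non-endpoint⇒¬incident : ∀ x k → x ≢ first k → x ≢ second k → incident? G x k ≡ false
  non-endpoint⇒¬incident x k x≢first x≢second with x Fin.≟ first k | x Fin.≟ second k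
  ... | yes x≡first | _            = ⊥-elim (x≢first x≡first)
  ... | no _        | yes x≡second = ⊥-elim (x≢second x≡second)
  ... | no _        | no _         = refl

  load-inc : ∀ s k x → load G (inc k s) x ≡ load G s x + (if incident? G x k then 1 else 0)
  load-inc s k x = sum-update (λ j → if incident? G x j then s j else 0)
    (λ j → if incident? G x j then inc k s j else 0) k _ (at-k (incident? G x k)) elsewhere
    where
    at-k : ∀ b → (if b then inc k s k else 0) ≡ (if b then s k else 0) + (if b then 1 else 0)
    at-k true  = trans (VecP.updateAt-updates k s) (ℕP.+-comm 1 (s k))
    at-k false = refl
    elsewhere : ∀ j → j ≢ k → (if incident? G x j then inc k s j else 0) ≡ (if incident? G x j then s j else 0)
    elsewhere j j≢k = cong (λ z → if incident? G x j then z else 0) (VecP.updateAt-minimal j k s j≢k)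

  load-inc-incident : ∀ s k x → incident? G x k ≡ true → load G (inc k s) x ≡ suc (load G s x)
  load-inc-incident s k x inc = trans (load-inc s k x)
    (trans (cong (λ b → load G s x + (if b then 1 else 0)) inc) (ℕP.+-comm (load G s x) 1))

  load-inc-¬incident : ∀ s k x → incident? G x k ≡ false → load G (inc k s) x ≡ load G s x
  load-inc-¬incident s k x ¬incident = trans (load-inc s k x)
    (trans (cong (λ b → load G s x + (if b then 1 else 0)) ¬incident) (ℕP.+-identityʳ (load G s x)))

  load-inc-≥ : ∀ s k x → load G s x ≤ load G (inc k s) x
  load-inc-≥ s k x = subst (load G s x ≤_) (sym (load-inc s k x)) (ℕP.m≤m+n _ _)

  dec : Fin m → Sol m → Sol m
  dec k s = updateAt s k ℕ.pred

  dec-≤ : ∀ s k j → dec k s j ≤ s j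
  dec-≤ s k j with j Fin.≟ k
  ... | yes refl = subst (_≤ s j) (sym (VecP.updateAt-updates j s)) ℕP.pred[n]≤n
  ... | no j≢k   = ℕP.≤-reflexive (VecP.updateAt-minimal j k s j≢k)

  load-dec-≤ : ∀ s k x → load G (dec k s) x ≤ load G s x
  load-dec-≤ s k x = sumℕ-mono (λ j → guarded (incident? G x j) (dec-≤ s k j))
    where
    guarded : ∀ b {y z} → y ≤ z → (if b then y else 0) ≤ (if b then z else 0)
    guarded true  y≤z = y≤z
    guarded false _   = z≤n

  sum-inc : ∀ (s : Sol m) k → sumℕ (inc k s) ≡ suc (sumℕ s)
  sum-inc s k = trans (sum-update s (inc k s) k 1 (trans (VecP.updateAt-updates k {suc} s) (ℕP.+-comm 1 (s k)))
                                  (λ j j≢k → VecP.updateAt-minimal j k {suc} s j≢k))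
                      (ℕP.+-comm (sumℕ s) 1)

  tight-stays : ∀ s s' x → load G s x ≤ load G s' x → load G s' x ≤ w x → Tight G w s x → Tight G w s' x
  tight-stays s s' x ≤load feasible tight = ℕP.≤-antisym feasible (subst (_≤ load G s' x) tight ≤load)

  blocked-edge-has-tight-end : ∀ s k → Feasible G w s → ¬ Feasible G w (inc k s) →
    Tight G w s (first k) ⊎ Tight G w s (second k)
  blocked-edge-has-tight-end s k feasible infeasible
    with FinP.¬∀⟶∃¬ n (λ x → load G (inc k s) x ≤ w x) (λ x → load G (inc k s) x ℕP.≤? w x) infeasible
  ... | x , overloaded = endpoint (incident? G x k) refl
    where
    endpoint : ∀ b → incident? G x k ≡ b → Tight G w s (first k) ⊎ Tight G w s (second k)
    endpoint false ¬incident =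
      ⊥-elim (overloaded (subst (_≤ w x) (sym (load-inc-¬incident s k x ¬incident)) (feasible x)))
    endpoint true incident =
      Sum.map (λ x≡first → subst (Tight G w s) x≡first tight) (λ x≡second → subst (Tight G w s) x≡second tight)
              (incident⇒endpoint x k incident)
      where
      tight : Tight G w s x
      tight = ℕP.≤-antisym (feasible x)
        (ℕP.≤-pred (subst (w x <_) (load-inc-incident s k x incident) (ℕP.≰⇒> overloaded)))

  uncovered? : ∀ s (j : Fin m) → Dec (¬ Tight G w s (first j) × ¬ Tight G w s (second j))
  uncovered? s j = ¬? (load G s (first j) ℕP.≟ w (first j)) ×-dec ¬? (load G s (second j) ℕP.≟ w (second j))

  W₁ : ℕ
  W₁ = Wtot w + 1

  penalty : Sol m → ℕ
  penalty s = W₁ * uncovered G w s + (m + 1) * W₁ * violated G w s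

  fitness-as-difference : ∀ s → fitness G w s ≡ + sumℕ s ℤ.- + penalty s
  fitness-as-difference s = begin
      + sumℕ s ℤ.- + b ℤ.- + c
    ≡⟨ ℤP.+-assoc (+ sumℕ s) (ℤ.- (+ b)) (ℤ.- (+ c)) ⟩
      + sumℕ s ℤ.+ (ℤ.- (+ b) ℤ.+ ℤ.- (+ c))
    ≡⟨ cong (λ x → + sumℕ s ℤ.+ x) (sym (ℤP.neg-distrib-+ (+ b) (+ c))) ⟩
      + sumℕ s ℤ.- (+ b ℤ.+ + c)
    ≡⟨ cong (λ x → + sumℕ s ℤ.- x) (sym (ℤP.pos-+ b c)) ⟩
      + sumℕ s ℤ.- + penalty s ∎
    where
    open ≡-Reasoning
    b c : ℕ
    b = W₁ * uncovered G w s
    c = (m + 1) * W₁ * violated G w s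

  fitness-<⇒ : ∀ s s' → fitness G w s ℤ.< fitness G w s' → sumℕ s + penalty s' < sumℕ s' + penalty s
  fitness-<⇒ s s' lt = difference-<⇒ (sumℕ s) (penalty s) (sumℕ s') (penalty s')
    (subst₂ ℤ._<_ (fitness-as-difference s) (fitness-as-difference s') lt)

  fitness-<⇐ : ∀ s s' → sumℕ s + penalty s' < sumℕ s' + penalty s → fitness G w s ℤ.< fitness G w s'
  fitness-<⇐ s s' lt = subst₂ ℤ._<_ (sym (fitness-as-difference s)) (sym (fitness-as-difference s'))
    (difference-<⇐ (sumℕ s) (penalty s) (sumℕ s') (penalty s') lt)

  -- A feasible solution is penalised only for its uncovered edges, which costs
  -- less than a single violated constraint costs an infeasible one.
  penalty-feasible : ∀ s → Feasible G w s → penalty s ≡ W₁ * uncovered G w s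
  penalty-feasible s feasible = begin
      W₁ * uncovered G w s + (m + 1) * W₁ * violated G w s
    ≡⟨ cong (λ c → W₁ * uncovered G w s + (m + 1) * W₁ * c)
            (count-zero (λ v → w v ℕ.<? load G s v) (λ v over → ℕP.<⇒≱ over (feasible v))) ⟩
      W₁ * uncovered G w s + (m + 1) * W₁ * 0
    ≡⟨ cong (λ x → W₁ * uncovered G w s + x) (ℕP.*-zeroʳ ((m + 1) * W₁)) ⟩
      W₁ * uncovered G w s + 0
    ≡⟨ ℕP.+-identityʳ _ ⟩
      W₁ * uncovered G w s ∎
    where open ≡-Reasoning

  penalty-feasible-< : ∀ s → Feasible G w s → penalty s < (m + 1) * W₁
  penalty-feasible-< s feasible = begin-strict
      penalty s                  ≡⟨ penalty-feasible s feasible ⟩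
      W₁ * uncovered G w s       ≤⟨ ℕP.*-monoʳ-≤ W₁ (count-≤ (uncovered? s)) ⟩
      W₁ * m                     <⟨ ℕP.m<m+n (W₁ * m) (ℕP.m≤n+m 1 (Wtot w)) ⟩
      W₁ * m + (Wtot w + 1)      ≡⟨ rearrange (Wtot w) m ⟩
      (m + 1) * W₁               ∎
    where
    open ℕP.≤-Reasoning
    rearrange : ∀ W m → (W + 1) * m + (W + 1) ≡ (m + 1) * (W + 1)
    rearrange = solve-∀

  penalty-infeasible : ∀ s → ¬ Feasible G w s → (m + 1) * W₁ ≤ penalty s
  penalty-infeasible s infeasible
    with FinP.¬∀⟶∃¬ n (λ v → load G s v ≤ w v) (λ v → load G s v ℕP.≤? w v) infeasible
  ... | v , overloaded = ℕP.≤-trans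
    (subst (_≤ (m + 1) * W₁ * violated G w s) (ℕP.*-identityʳ _)
           (ℕP.*-monoʳ-≤ ((m + 1) * W₁) (count-pos (λ v → w v ℕ.<? load G s v) v (ℕP.≰⇒> overloaded))))
    (ℕP.m≤n+m _ _)

  uncovered-antitone : ∀ s s' → (∀ x → load G s x ≤ load G s' x) → Feasible G w s' →
    uncovered G w s' ≤ uncovered G w s
  uncovered-antitone s s' ≤load feasible' = count-mono (uncovered? s') (uncovered? s) λ j (¬tight₁ , ¬tight₂) →
    (λ tight → ¬tight₁ (tight-stays s s' (first j) (≤load (first j)) (feasible' (first j)) tight)) ,
    (λ tight → ¬tight₂ (tight-stays s s' (second j) (≤load (second j)) (feasible' (second j)) tight))

  increment-accepted : ∀ s k → Feasible G w s → Feasible G w (inc k s) →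
    fitness G w s ℤ.< fitness G w (inc k s)
  increment-accepted s k feasible feasible' = fitness-<⇐ s (inc k s)
    (subst (sumℕ s + penalty (inc k s) <_) (cong (_+ penalty s) (sym (sum-inc s k)))
           (s≤s (ℕP.+-monoʳ-≤ (sumℕ s) penalty-≤)))
    where
    penalty-≤ : penalty (inc k s) ≤ penalty s
    penalty-≤ = subst₂ _≤_ (sym (penalty-feasible (inc k s) feasible')) (sym (penalty-feasible s feasible))
      (ℕP.*-monoʳ-≤ W₁ (uncovered-antitone s (inc k s) (load-inc-≥ s k) feasible'))

  infeasible-increment-rejected : ∀ s k → Feasible G w s → ¬ Feasible G w (inc k s) →
    ¬ (fitness G w s ℤ.< fitness G w (inc k s))
  infeasible-increment-rejected s k feasible infeasible better =
    ℕP.<⇒≱ (ℕP.<-≤-trans (penalty-feasible-< s feasible) (penalty-infeasible (inc k s) infeasible))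
      (ℕP.+-cancelˡ-≤ (sumℕ s) _ _ (ℕP.≤-pred (subst (sumℕ s + penalty (inc k s) <_)
        (cong (_+ penalty s) (sum-inc s k)) (fitness-<⇒ s (inc k s) better))))

  decrement-rejected : ∀ s k → Feasible G w s → ¬ (fitness G w s ℤ.< fitness G w (dec k s))
  decrement-rejected s k feasible better = ℕP.<⇒≱ (fitness-<⇒ s (dec k s) better)
    (ℕP.+-mono-≤ (sumℕ-mono (dec-≤ s k)) penalty-≤)
    where
    penalty-≤ : penalty s ≤ penalty (dec k s)
    penalty-≤ = ℕP.≤-trans (ℕP.≤-reflexive (penalty-feasible s feasible))
      (ℕP.≤-trans (ℕP.*-monoʳ-≤ W₁ (uncovered-antitone (dec k s) s (load-dec-≤ s k) feasible)) (ℕP.m≤m+n _ _))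

  step-from-feasible : ∀ s → Feasible G w s → ∀ j b →
    rlsStep G w s j b ≡ s ⊎ (rlsStep G w s j b ≡ inc j s × Feasible G w (inc j s))
  step-from-feasible s feasible j true with fitness G w s ℤ.<? fitness G w (inc j s)
  ... | no _       = inj₁ refl
  ... | yes better = inj₂ (refl , decidable-stable (feasible? G w (inc j s))
                                    (λ infeasible → infeasible-increment-rejected s j feasible infeasible better))
  step-from-feasible s feasible j false with fitness G w s ℤ.<? fitness G w (dec j s)
  ... | no _       = inj₁ refl
  ... | yes better = ⊥-elim (decrement-rejected s j feasible better)

  increment-step : ∀ s k → Feasible G w s → Feasible G w (inc k s) → rlsStep G w s k true ≡ inc k s
  increment-step s k feasible feasible' with fitness G w s ℤ.<? fitness G w (inc k s)
  ... | yes _      = refl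
  ... | no ¬better = ⊥-elim (¬better (increment-accepted s k feasible feasible'))

  notDone-maximal : ∀ {s} → Maximal G w s → ∀ t → notDone G w t s ≡ 0ℚ
  notDone-maximal {s} maximal t with maximal? G w s
  ... | yes _       = refl
  ... | no ¬maximal = ⊥-elim (¬maximal maximal)

  notDone-zero : ∀ {s} → ¬ Maximal G w s → notDone G w 0 s ≡ 1ℚ
  notDone-zero {s} ¬maximal with maximal? G w s
  ... | yes maximal = ⊥-elim (¬maximal maximal)
  ... | no _        = refl

  notDone-suc : ∀ {s} → ¬ Maximal G w s → ∀ t →
    notDone G w (suc t) s ≡ average (λ j b → notDone G w t (rlsStep G w s j b))
  notDone-suc {s} ¬maximal t with maximal? G w s
  ... | yes maximal = ⊥-elim (¬maximal maximal)
  ... | no _        = refl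

  expected-maximal : ∀ {s} → Maximal G w s → ∀ N → expectedUpTo G w s N ≡ 0ℚ
  expected-maximal maximal zero    = refl
  expected-maximal maximal (suc N) =
    trans (cong₂ ℚ._+_ (expected-maximal maximal N) (notDone-maximal maximal N)) (ℚP.+-identityˡ 0ℚ)

  expected-unfold : ∀ {s} → ¬ Maximal G w s → ∀ N →
    expectedUpTo G w s (suc N) ≡ 1ℚ ℚ.+ average (λ j b → expectedUpTo G w (rlsStep G w s j b) N)
  expected-unfold {s} ¬maximal zero = begin
      0ℚ ℚ.+ notDone G w 0 s                  ≡⟨ cong (0ℚ ℚ.+_) (notDone-zero ¬maximal) ⟩
      0ℚ ℚ.+ 1ℚ                              ≡⟨ ℚP.+-identityˡ 1ℚ ⟩
      1ℚ                                      ≡⟨ sym (ℚP.+-identityʳ 1ℚ) ⟩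
      1ℚ ℚ.+ 0ℚ                              ≡⟨ cong (1ℚ ℚ.+_) (sym (average-0 {m})) ⟩
      1ℚ ℚ.+ average {m} (λ _ _ → 0ℚ)        ∎
    where open ≡-Reasoning
  expected-unfold {s} ¬maximal (suc N) = begin
      expectedUpTo G w s (suc N) ℚ.+ notDone G w (suc N) s
    ≡⟨ cong₂ ℚ._+_ (expected-unfold ¬maximal N) (notDone-suc ¬maximal N) ⟩
      (1ℚ ℚ.+ average E) ℚ.+ average D
    ≡⟨ ℚP.+-assoc 1ℚ (average E) (average D) ⟩
      1ℚ ℚ.+ (average E ℚ.+ average D)
    ≡⟨ cong (1ℚ ℚ.+_) (average-+ E D) ⟩
      1ℚ ℚ.+ average (λ j b → E j b ℚ.+ D j b) ∎
    where
    open ≡-Reasoning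
    E D : Fin m → Bool → ℚ
    E j b = expectedUpTo G w (rlsStep G w s j b) N
    D j b = notDone G w N (rlsStep G w s j b)

  module Drift (Inv : Sol m → Set) (Φ : Sol m → ℕ)
    (preserved : ∀ s → Inv s → ∀ j b → Inv (rlsStep G w s j b))
    (nonincreasing : ∀ s → Inv s → ∀ j b → Φ (rlsStep G w s j b) ≤ Φ s)
    (progress : ∀ s → Inv s → ¬ Maximal G w s → Σ (Fin m) λ j → Σ Bool λ b → Φ (rlsStep G w s j b) < Φ s)
    where

    expected-time-≤ : ∀ N s → Inv s → expectedUpTo G w s N ℚ.≤ ⟦ 2 * m * Φ s ⟧
    expected-time-≤ zero s _ = ⟦⟧-nonneg (2 * m * Φ s)
    expected-time-≤ (suc N) s inv = by-cases (maximal? G w s)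
      where
      by-cases : Dec (Maximal G w s) → expectedUpTo G w s (suc N) ℚ.≤ ⟦ 2 * m * Φ s ⟧
      by-cases (yes maximal) = ℚP.≤-trans (ℚP.≤-reflexive (expected-maximal maximal (suc N))) (⟦⟧-nonneg (2 * m * Φ s))
      by-cases (no ¬maximal) with progress s inv ¬maximal
      ... | j₀ , b₀ , decrease = ℚP.≤-trans (ℚP.≤-reflexive (expected-unfold ¬maximal N))
        (drift-step (λ j b → expectedUpTo G w (rlsStep G w s j b) N) (Φ s) (λ j b → Φ (rlsStep G w s j b))
                    (λ j b → expected-time-≤ N (rlsStep G w s j b) (preserved s inv j b))
                    (nonincreasing s inv) j₀ b₀ decrease)

  module Potential (u v : Fin n) where

    -- x may be left uncovered only if it is u or v.
    Good : Sol m → Fin n → Set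
    Good s x = Tight G w s x ⊎ (x ≡ u ⊎ x ≡ v)

    AlmostCovering : Sol m → Set
    AlmostCovering s = Feasible G w s × (∀ k → Good s (first k) ⊎ Good s (second k))

    slack : Sol m → Fin n → ℕ
    slack s x = w x ∸ load G s x

    Φ : Sol m → ℕ
    Φ s = slack s u + slack s v

    Φ-≤ : ∀ s → Φ s ≤ maxℕ w + maxℕ w
    Φ-≤ s = ℕP.+-mono-≤ (ℕP.≤-trans (ℕP.m∸n≤m (w u) (load G s u)) (≤-maxℕ w u))
                        (ℕP.≤-trans (ℕP.m∸n≤m (w v) (load G s v)) (≤-maxℕ w v))

    -- Feasible increments keep tight nodes tight.
    almost-covering-inc : ∀ s k → AlmostCovering s → Feasible G w (inc k s) → AlmostCovering (inc k s)
    almost-covering-inc s k (_ , covered) feasible' = feasible' , λ j → Sum.map still-good still-good (covered j)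
      where
      still-good : ∀ {x} → Good s x → Good (inc k s) x
      still-good {x} (inj₁ tight) = inj₁ (tight-stays s (inc k s) x (load-inc-≥ s k x) (feasible' x) tight)
      still-good     (inj₂ x∈uv)  = inj₂ x∈uv

    slack-inc-≤ : ∀ s k x → slack (inc k s) x ≤ slack s x
    slack-inc-≤ s k x = ℕP.∸-monoʳ-≤ (w x) (load-inc-≥ s k x)

    Φ-inc-≤ : ∀ s k → Φ (inc k s) ≤ Φ s
    Φ-inc-≤ s k = ℕP.+-mono-≤ (slack-inc-≤ s k u) (slack-inc-≤ s k v)

    slack-inc-< : ∀ s k x → incident? G x k ≡ true → Feasible G w (inc k s) → slack (inc k s) x < slack s x
    slack-inc-< s k x incident feasible' = subst (λ l → w x ∸ l < slack s x) (sym (load-inc-incident s k x incident))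
      (ℕP.∸-monoʳ-< (ℕP.n<1+n (load G s x)) (subst (_≤ w x) (load-inc-incident s k x incident) (feasible' x)))

    Φ-inc-< : ∀ s k x → x ≡ u ⊎ x ≡ v → slack (inc k s) x < slack s x → Φ (inc k s) < Φ s
    Φ-inc-< s k x (inj₁ refl) lower = ℕP.+-mono-≤ lower (slack-inc-≤ s k v)
    Φ-inc-< s k x (inj₂ refl) lower =
      subst (_≤ Φ s) (ℕP.+-suc (slack (inc k s) u) _) (ℕP.+-mono-≤ (slack-inc-≤ s k u) lower)

    increasable⇒¬tight : ∀ s k x → incident? G x k ≡ true → Feasible G w (inc k s) → ¬ Tight G w s x
    increasable⇒¬tight s k x incident feasible' tight =
      ℕP.<-irrefl tight (subst (_≤ w x) (load-inc-incident s k x incident) (feasible' x))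

    -- RLS steps keep the invariant and never raise Φ, since they either stay
    -- or perform a feasible increment.
    step-preserves : ∀ s → AlmostCovering s → ∀ j b → AlmostCovering (rlsStep G w s j b)
    step-preserves s inv j b with step-from-feasible s (proj₁ inv) j b
    ... | inj₁ stays              = subst AlmostCovering (sym stays) inv
    ... | inj₂ (moves , feasible') = subst AlmostCovering (sym moves) (almost-covering-inc s j inv feasible')

    step-nonincreasing : ∀ s → AlmostCovering s → ∀ j b → Φ (rlsStep G w s j b) ≤ Φ s
    step-nonincreasing s inv j b with step-from-feasible s (proj₁ inv) j b
    ... | inj₁ stays       = ℕP.≤-reflexive (cong Φ stays)
    ... | inj₂ (moves , _) = subst (_≤ Φ s) (cong Φ (sym moves)) (Φ-inc-≤ s j)

    -- If s is not maximal, some e_k can be increased feasibly; its good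
    -- endpoint is not tight, so it is u or v, and the increment lowers Φ.
    progress : ∀ s → AlmostCovering s → ¬ Maximal G w s →
      Σ (Fin m) λ j → Σ Bool λ b → Φ (rlsStep G w s j b) < Φ s
    progress s (feasible , covered) ¬maximal
      with FinP.¬∀⟶∃¬ m (λ k → ¬ Feasible G w (inc k s)) (λ k → ¬? (feasible? G w (inc k s)))
                        (λ blocked → ¬maximal (feasible , blocked))
    ... | k , ¬blocked = k , true , subst (λ s' → Φ s' < Φ s) (sym (increment-step s k feasible feasible'))
                                          (lowered (covered k))
      where
      feasible' : Feasible G w (inc k s)
      feasible' = decidable-stable (feasible? G w (inc k s)) ¬blocked
      lowered-at : ∀ x → incident? G x k ≡ true → Good s x → Φ (inc k s) < Φ s
      lowered-at x incident (inj₁ tight) = ⊥-elim (increasable⇒¬tight s k x incident feasible' tight)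
      lowered-at x incident (inj₂ x∈uv)  = Φ-inc-< s k x x∈uv (slack-inc-< s k x incident feasible')
      lowered : Good s (first k) ⊎ Good s (second k) → Φ (inc k s) < Φ s
      lowered (inj₁ good) = lowered-at (first k) (incident-first k) good
      lowered (inj₂ good) = lowered-at (second k) (incident-second k) good

    open Drift AlmostCovering Φ step-preserves step-nonincreasing progress public

time-bound-arith : ∀ k m M Φ → k ≤ suc m → Φ ≤ M + M → 2 * k * Φ ≤ 4 * M * suc m
time-bound-arith k m M Φ k≤ Φ≤ =
  ℕP.≤-trans (ℕP.*-mono-≤ (ℕP.*-monoʳ-≤ 2 k≤) Φ≤) (ℕP.≤-reflexive (rearrange m M))
  where
  rearrange : ∀ m M → 2 * suc m * (M + M) ≡ 4 * M * suc m
  rearrange = solve-∀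

-- Inserting edge e_j = {u, v} (with weight 0) into the graph removeAt H j.
module Insertion {n m} (w : Fin n → ℕ) (H : Graph n (suc m)) (j : Fin (suc m)) where
  G₀ : Graph n m
  G₀ = removeAt H j

  open Dynamics H w
  open Potential (proj₁ (H j)) (proj₂ (H j))

  -- The new edge carries weight 0, so all loads are unchanged.
  load-insert : ∀ (s : Sol m) x → load H (insertAt s j 0) x ≡ load G₀ s x
  load-insert s x = trans (sum-removeAt (λ k → if incident? H x k then insertAt s j 0 k else 0) j)
    (cong₂ _+_ (new-edge (incident? H x j))
               (sumℕ-ext λ k → cong (λ z → if incident? H x (punchIn j k) then z else 0) (VecP.insertAt-punchIn s j 0 k)))
    where
    new-edge : ∀ b → (if b then insertAt s j 0 j else 0) ≡ 0
    new-edge true  = VecP.insertAt-lookup s j 0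
    new-edge false = refl

  -- Every old edge still has a tight endpoint, and the new edge touches u.
  initially-almost-covering : ∀ s → Maximal G₀ w s → AlmostCovering (insertAt s j 0)
  initially-almost-covering s (feasible , blocked) =
    (λ x → subst (_≤ w x) (sym (load-insert s x)) (feasible x)) , covered
    where
    tight-in-H : ∀ {x} → Tight G₀ w s x → Tight H w (insertAt s j 0) x
    tight-in-H {x} = trans (load-insert s x)
    covered : ∀ k → Good (insertAt s j 0) (first k) ⊎ Good (insertAt s j 0) (second k)
    covered k with j Fin.≟ k
    ... | yes refl = inj₁ (inj₂ (inj₁ refl))
    ... | no j≢k = subst (λ k → Good (insertAt s j 0) (first k) ⊎ Good (insertAt s j 0) (second k))
                         (FinP.punchIn-punchOut j≢k)
                         (Sum.map (inj₁ ∘′ tight-in-H) (inj₁ ∘′ tight-in-H)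
                                  (Dynamics.blocked-edge-has-tight-end G₀ w s (punchOut j≢k) feasible (blocked (punchOut j≢k))))

  insertion-bound : ∀ s → Maximal G₀ w s → ∀ N →
    expectedUpTo H w (insertAt s j 0) N ℚ.≤ ⟦ 4 * maxℕ w * suc m ⟧
  insertion-bound s maximal N = ℚP.≤-trans (expected-time-≤ N s₀ (initially-almost-covering s maximal))
    (⟦⟧-mono (time-bound-arith (suc m) m (maxℕ w) (Φ s₀) ℕP.≤-refl (Φ-≤ s₀)))
    where
    s₀ : Sol (suc m)
    s₀ = insertAt s j 0

module Deletion {n m} (w : Fin n → ℕ) (H : Graph n (suc m)) (j : Fin (suc m)) where
  G₀ : Graph n m
  G₀ = removeAt H j

  u v : Fin n
  u = proj₁ (H j)
  v = proj₂ (H j)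

  open Dynamics G₀ w
  open Potential u v

  load-remove : ∀ s x → load H s x ≡ (if incident? H x j then s j else 0) + load G₀ (removeAt s j) x
  load-remove s x = sum-removeAt (λ k → if incident? H x k then s k else 0) j

  tight⇒good : ∀ s x → Tight H w s x → Good (removeAt s j) x
  tight⇒good s x tight with x Fin.≟ u | x Fin.≟ v
  ... | yes x≡u | _       = inj₂ (inj₁ x≡u)
  ... | no _    | yes x≡v = inj₂ (inj₂ x≡v)
  ... | no x≢u  | no x≢v  = inj₁ (trans (sym (cong (λ b → (if b then s j else 0) + load G₀ (removeAt s j) x)
                                                   (Dynamics.non-endpoint⇒¬incident H w x j x≢u x≢v)))
                                        (trans (sym (load-remove s x)) tight))

  initially-almost-covering : ∀ s → Maximal H w s → AlmostCovering (removeAt s j)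
  initially-almost-covering s (feasible , blocked) = feasible₀ , covered
    where
    feasible₀ : Feasible G₀ w (removeAt s j)
    feasible₀ x = ℕP.≤-trans (subst (load G₀ (removeAt s j) x ≤_) (sym (load-remove s x)) (ℕP.m≤n+m _ _)) (feasible x)
    covered : ∀ k → Good (removeAt s j) (first k) ⊎ Good (removeAt s j) (second k)
    covered k = Sum.map (tight⇒good s _) (tight⇒good s _)
      (Dynamics.blocked-edge-has-tight-end H w s (punchIn j k) feasible (blocked (punchIn j k)))

  deletion-bound : ∀ s → Maximal H w s → ∀ N →
    expectedUpTo G₀ w (removeAt s j) N ℚ.≤ ⟦ 4 * maxℕ w * suc m ⟧
  deletion-bound s maximal N = ℚP.≤-trans (expected-time-≤ N s₀ (initially-almost-covering s maximal))
    (⟦⟧-mono (time-bound-arith m m (maxℕ w) (Φ s₀) (ℕP.n≤1+n m) (Φ-≤ s₀)))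
    where
    s₀ : Sol m
    s₀ = removeAt s j

-- Main theorem: after an insertion or a deletion the expected time is at most
-- 4·w_max·(m+1).
theorem4 : Σ ℕ λ C →
    ∀ (n m : ℕ) (w : Fin n → ℕ) → (∀ v → 1 ≤ w v) →
    (H : Graph n (suc m)) → Simple H → (j : Fin (suc m)) →
      (∀ (s : Sol m) → Maximal (removeAt H j) w s → ∀ (N : ℕ) →
         expectedUpTo H w (insertAt s j 0) N
           ℚ.≤ (+ (C * maxℕ w * suc m)) / 1)
      ×
      (∀ (s : Sol (suc m)) → Maximal H w s → ∀ (N : ℕ) →
         expectedUpTo (removeAt H j) w (removeAt s j) N
           ℚ.≤ (+ (C * maxℕ w * suc m)) / 1)
theorem4 = 4 , λ n m w _ H _ j → Insertion.insertion-bound w H j , Deletion.deletion-bound w H j
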